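{- Let $X$ be a finite temporal transit and $S\subseteq X$. Then $Z[S]=\{y:\exists x\in S,\ xZy\}$ is an archival upset of $X$.
   Context: A temporal transit is a structure $(X,R^{\triangleleft},R^{\triangleright},\le)$ where $\le$ is a partial order equal to the reflexive closure of $R^{\triangleright}$, and $R^{\triangleleft}$ is the converse of $R^{\triangleright}$. $\mathrm{Refl}(X)=\{v:vR^{\triangleright}v\}$. A subset $S$ is archival if for all $x,z$: if $x\notin S$, $z\in S$ and $zR^{\triangleleft}x$, then $R^{\triangleleft}[z]\cap{\uparrow}x\cap S\neq\emptyset$. On a finite temporal transit, $xBw$ means $w\le x$ and $\{v:w<v\le x\}\cap\mathrm{Refl}(X)=\emptyset$. With relational composition $R;R'=\{(x,z):\exists y\,(xRy\text{ and }yR'z)\}$, define $Z_0=\Delta_X$, $Z_{n+1}=Z_n;B;\le$, and $Z=\bigcup_{n\in\mathbb{N}}Z_n$. -}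

module Defs where

open import Data.Nat using (ℕ; zero; suc)
open import Data.Fin using (Fin)
open import Data.Fin.Subset using (Subset; _∈_)
open import Data.Product using (Σ; ∃; _×_; _,_)
open import Data.Sum using (_⊎_)
open import Relation.Nullary using (¬_; Dec)
open import Relation.Binary.PropositionalEquality using (_≡_)

-- The primitive relation is
-- R▷ (assumed decidable, automatic classically on a finite set); R◁ is its
-- converse and ≤ is its reflexive closure, which is required to be a
-- partial order (reflexivity is automatic).
record TemporalTransit (n : ℕ) : Set₁ where
  field
    R▷    : Fin n → Fin n → Set
    R▷?   : ∀ x y → Dec (R▷ x y)

  R◁ : Fin n → Fin n → Set
  R◁ x y = R▷ y x

  _≤_ : Fin n → Fin n → Set
  x ≤ y = x ≡ y ⊎ R▷ x y

  field
    ≤-antisym : ∀ {x y} → x ≤ y → y ≤ x → x ≡ y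
    ≤-trans   : ∀ {x y z} → x ≤ y → y ≤ z → x ≤ z

  _<_ : Fin n → Fin n → Set
  x < y = x ≤ y × ¬ (x ≡ y)

  Refl : Fin n → Set
  Refl v = R▷ v v

  ↑ : Fin n → Fin n → Set
  ↑ x y = x ≤ y

  B : Fin n → Fin n → Set
  B x w = w ≤ x × (∀ v → w < v → v ≤ x → ¬ Refl v)

  Zₙ : ℕ → Fin n → Fin n → Set
  Zₙ zero    x z = x ≡ z
  Zₙ (suc k) x z = ∃ λ y → ∃ λ y' → Zₙ k x y × B y y' × y' ≤ z

  Z : Fin n → Fin n → Set
  Z x y = ∃ λ k → Zₙ k x y

  Z[_] : Subset n → Fin n → Set
  Z[ S ] y = ∃ λ x → x ∈ S × Z x y

  IsUpset : (Fin n → Set) → Set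
  IsUpset U = ∀ x y → U x → x ≤ y → U y

  IsArchival : (Fin n → Set) → Set
  IsArchival U = ∀ x z → ¬ U x → U z → R◁ z x →
                 ∃ λ y → R◁ z y × ↑ x y × U y

-- Z[S] is an upset because every Z-path may end with an arbitrary ≤-step.
-- For archivality, let x R▷ z with z ∈ Z[S] and x ∉ Z[S].  If no reflexive
-- point lies in (x, z], then z B x and x ∈ Z[S]; otherwise a maximal reflexive
-- v in (x, z] (finiteness) satisfies z B v, so v ∈ Z[S], and v R▷ z because
-- v is reflexive.
module Submission where

open import Defs
open import Data.Nat using (zero; suc)
open import Data.Fin using (Fin; _≟_)
open import Data.Fin.Induction using (po-noetherian)
open import Data.Fin.Properties using (any?)
open import Data.Fin.Subset using (Subset)
open import Data.Product using (_×_; _,_; ∃)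
open import Data.Sum using (_⊎_; inj₁; inj₂)
open import Function using (flip)
open import Induction.WellFounded using (WellFounded; Acc; acc)
open import Relation.Binary using (Rel; Decidable; IsPartialOrder)
import Relation.Binary.Construct.NonStrictToStrict as ToStrict
open import Relation.Binary.PropositionalEquality using (_≡_; refl; isEquivalence)
open import Relation.Nullary using (¬_; yes; no; contradiction)
open import Relation.Nullary.Decidable using (_×-dec_; _⊎-dec_; ¬?)
open import Relation.Unary using (Pred) renaming (Decidable to Decidable₁)

∃-maximal : ∀ {n p r} {P : Pred (Fin n) p} {_⊏_ : Rel (Fin n) r} →
            WellFounded (flip _⊏_) → Decidable₁ P → Decidable _⊏_ →
            ∃ P → ∃ λ v → P v × ∀ w → P w → ¬ v ⊏ w
∃-maximal {P = P} {_⊏_} noetherian P? _⊏?_ (m , pm) = go (noetherian m) pm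
  where
  go : ∀ {m} → Acc (flip _⊏_) m → P m → ∃ λ v → P v × ∀ w → P w → ¬ v ⊏ w
  go {m} (acc rec) pm with any? (λ w → P? w ×-dec m ⊏? w)
  ... | yes (w , pw , m⊏w) = go (rec m⊏w) pw
  ... | no nothing-above   = m , pm , λ w pw m⊏w → nothing-above (w , pw , m⊏w)

module _ {n} (X : TemporalTransit n) where
  open TemporalTransit X

  ≤-isPartialOrder : IsPartialOrder _≡_ _≤_
  ≤-isPartialOrder = record
    { isPreorder = record
      { isEquivalence = isEquivalence
      ; reflexive     = inj₁
      ; trans         = ≤-trans
      }
    ; antisym = ≤-antisym
    }

  _≤?_ : Decidable _≤_
  x ≤? y = (x ≟ y) ⊎-dec R▷? x y

  _<?_ : Decidable _<_
  x <? y = (x ≤? y) ×-dec ¬? (x ≟ y)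

  <-trans : ∀ {x y z} → x < y → y < z → x < z
  <-trans = ToStrict.<-trans _≡_ _≤_ ≤-isPartialOrder

  Refl-≤⇒R▷ : ∀ {v z} → Refl v → v ≤ z → R▷ v z
  Refl-≤⇒R▷ rv (inj₁ refl) = rv
  Refl-≤⇒R▷ _  (inj₂ v▷z)  = v▷z

  B-refl : ∀ x → B x x
  B-refl x = inj₁ refl , λ v (x≤v , x≢v) v≤x _ → x≢v (≤-antisym x≤v v≤x)

  reflexive-between? : ∀ x z → Decidable₁ (λ v → (x < v × v ≤ z) × Refl v)
  reflexive-between? x z v = (x <? v ×-dec v ≤? z) ×-dec R▷? v v

  B-or-reflexive-between : ∀ {x z} → x ≤ z → B z x ⊎ ∃ λ v → x < v × Refl v × B z v
  B-or-reflexive-between {x} {z} x≤z with any? (reflexive-between? x z)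
  ... | no none  = inj₁ (x≤z , λ v x<v v≤z rv → none (v , (x<v , v≤z) , rv))
  ... | yes some with ∃-maximal (po-noetherian ≤-isPartialOrder) (reflexive-between? x z) _<?_ some
  ... | v , ((x<v , v≤z) , rv) , maximal =
    inj₂ (v , x<v , rv , v≤z , λ w v<w w≤z rw → maximal w ((<-trans x<v v<w , w≤z) , rw) v<w)

  Z-step : ∀ {x y w z} → Z x y → B y w → w ≤ z → Z x z
  Z-step (k , xZₖy) yBw w≤z = suc k , _ , _ , xZₖy , yBw , w≤z

  Z-≤-closed : ∀ {x y z} → Z x y → y ≤ z → Z x z
  Z-≤-closed (zero  , refl)                       y≤z = Z-step (zero , refl) (B-refl _) y≤z
  Z-≤-closed (suc k , _ , _ , xZₖu , uBw , w≤y) y≤z = suc k , _ , _ , xZₖu , uBw , ≤-trans w≤y y≤z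

  Z[]-upset : ∀ S → IsUpset Z[ S ]
  Z[]-upset S _ _ (s , s∈S , sZy) y≤z = s , s∈S , Z-≤-closed sZy y≤z

  Z[]-archival : ∀ S → IsArchival Z[ S ]
  Z[]-archival S x z x∉ (s , s∈S , sZz) x▷z with B-or-reflexive-between (inj₂ x▷z)
  ... | inj₁ zBx                  = contradiction (s , s∈S , Z-step sZz zBx (inj₁ refl)) x∉
  ... | inj₂ (v , (x≤v , _) , rv , zBv@(v≤z , _)) =
    v , Refl-≤⇒R▷ rv v≤z , x≤v , s , s∈S , Z-step sZz zBv (inj₁ refl)

lemma4p8 : ∀ {n} (X : TemporalTransit n) (S : Subset n) →
           TemporalTransit.IsArchival X (TemporalTransit.Z[_] X S) ×
           TemporalTransit.IsUpset X (TemporalTransit.Z[_] X S)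
lemma4p8 X S = Z[]-archival X S , Z[]-upset X S
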